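{- Let $D$ be a (possibly infinite) set and let $\varphi:D^3\to D$ satisfy $\varphi(x,x,y)=\varphi(y,x,x)=y$ for all $x,y\in D$. Then there exist operations $f_1,f_3,f_5,\dots$, with $f_m:D^m\to D$, all belonging to the clone generated by $\varphi$, which satisfy the Catalan identities. Conversely, if a sequence of operations $f_1,f_3,\dots$ on $D$ (with $f_m$ of arity $m$) satisfies the Catalan identities, then $f_3$ satisfies $f_3(x,x,y)=f_3(y,x,x)=y$ for all $x,y\in D$.
   Context: The clone generated by $\varphi$ is the smallest set of finitary operations on $D$ containing $\varphi$ and all projections $(x_1,\dots,x_n)\mapsto x_i$ and closed under composition $f\circ(g_1,\dots,g_n)$. A sequence $(\psi_m)_{m\text{ odd}}$ with $\psi_m:D^m\to D$ satisfies the Catalan identities if $\psi_1(x)=x$ for all $x$, and for every odd $m\ge3$, every $i\in[m-1]$ and all $x_1,\dots,x_m\in D$ with $x_i=x_{i+1}$ we have $\psi_m(x_1,\dots,x_m)=\psi_{m-2}(x_1,\dots,x_{i-1},x_{i+2},\dots,x_m)$. -}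

module Defs where

open import Level using (Level)
open import Data.Nat using (ℕ; zero; suc; _+_; _*_)
open import Data.Fin using (Fin; zero; suc; inject₁)
open import Data.Vec.Functional using (Vector; removeAt)
open import Relation.Binary.PropositionalEquality using (_≡_)
open import Data.Product using (_×_)

Op : ∀ {a} → Set a → ℕ → Set a
Op D n = (Fin n → D) → D

_≗ₒ_ : ∀ {a} {D : Set a} {n : ℕ} → Op D n → Op D n → Set a
f ≗ₒ g = ∀ x → f x ≡ g x

-- The clone generated by a ternary operation φ: the smallest set of finitary
-- operations containing φ and all projections, closed under composition
-- f ∘ (g₁,…,gₖ) (and, as a set of functions, under extensional equality).
data InClone {a} {D : Set a} (φ : Op D 3) : {n : ℕ} → Op D n → Set a where
  gen  : InClone φ φ
  proj : ∀ {n} (i : Fin n) → InClone φ (λ x → x i)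
  comp : ∀ {k n} {f : Op D k} {g : Fin k → Op D n} →
         InClone φ f → (∀ j → InClone φ (g j)) →
         InClone φ (λ x → f (λ j → g j x))
  ext  : ∀ {n} {f g : Op D n} → InClone φ f → f ≗ₒ g → InClone φ g

-- odd k = 2k+1, defined recursively so that odd (suc k) = 2 + odd k definitionally.
odd : ℕ → ℕ
odd zero    = 1
odd (suc k) = suc (suc (odd k))

OddOps : ∀ {a} → Set a → Set a
OddOps D = (k : ℕ) → Op D (odd k)

-- Remove positions i and i+1 (0-based) from a vector of length n+2.
remove2 : ∀ {a} {D : Set a} {n : ℕ} → Vector D (suc (suc n)) → Fin (suc n) → Vector D n
remove2 x i = removeAt (removeAt x (inject₁ i)) i

-- Catalan identities: ψ₁(x) = x, and for odd m = 2k+3 ≥ 3 and i ∈ [m-1]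
-- (here 0-based i : Fin (m-1), positions i and i+1), x_i = x_{i+1} implies
-- ψ_m(x) = ψ_{m-2}(x with positions i, i+1 removed).
Catalan : ∀ {a} {D : Set a} → OddOps D → Set a
Catalan {D = D} ψ =
  (∀ (x : Fin 1 → D) → ψ 0 x ≡ x zero) ×
  (∀ (k : ℕ) (i : Fin (suc (odd k))) (x : Fin (odd (suc k)) → D) →
     x (inject₁ i) ≡ x (suc i) → ψ (suc k) x ≡ ψ k (remove2 x i))

module Submission where

-- Write a word x₁ … x₂ₖ₊₁ as its pairs (b₁ , c₁) … (bₖ , cₖ) and last letter z.  A nonzero P ∈ {0,1}ᵏ
-- selects pairs to contract, giving a word contract P w with k − 1 pairs: the first selected pair
-- (bᵢ , cᵢ) is absorbed into the following letter d, which becomes m bᵢ cᵢ d, and later selected pairs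
-- are treated similarly.  The operation is defined by recursion on k as
--   f w = cube k (P ↦ f (contract P w)),
--   cube (n + 2) y = m (cube (n + 1) y0·) (cube (n + 1) y1·) (y 10ⁿ⁺¹),
-- which never reads y at P = 0.  By m x x y = y = m y x x, cube k y = y 0ᵏ whenever y does not depend on
-- one coordinate.  If w has two equal adjacent letters, the coordinate of the pair where they sit is such
-- a coordinate once y 0ᵏ is set to f of the cancelled word: flipping it changes the contracted word only
-- by cancellations in shorter words (induction on k), and contracting that pair alone is the cancellation.
-- Clone membership: the same construction, run in the algebra of (2k+1)-ary operations on the
-- projections, produces f, since evaluation at a point is a homomorphism.

open import Defs

module Construction where
  open import Data.Bool using (Bool; true; false; if_then_else_)
  open import Data.Fin using (Fin; zero; suc; inject₁)
  open import Data.Bool.ListAction using (or)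
  open import Data.List using (List; []; _∷_; _++_; length; map; replicate)
  open import Data.List.Properties using (length-replicate; length-++; length-map)
  open import Data.List.Relation.Unary.All using (All; []; _∷_)
  open import Data.Nat using (ℕ; zero; suc; _<_; _≤_; s≤s; z≤n)
  open import Data.Nat.Properties using (≤-refl; ≤-trans; <-≤-trans; m≤n⇒m≤1+n; n<1+n; m<m+n; suc-injective)
  open import Data.Product using (_×_; _,_; proj₁; proj₂; Σ)
  import Data.Product as ×
  open import Data.Sum using (_⊎_; inj₁; inj₂)
  open import Function using (_∘_)
  open import Level using (_⊔_)
  open import Relation.Binary.PropositionalEquality

  cong₃ : ∀ {a b} {A : Set a} {B : Set b} (f : A → A → A → B) {x x′ y y′ z z′ : A} →
          x ≡ x′ → y ≡ y′ → z ≡ z′ → f x y z ≡ f x′ y′ z′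
  cong₃ f refl refl refl = refl

  setAt : List Bool → ℕ → Bool → List Bool
  setAt []      k       b = []
  setAt (p ∷ P) zero    b = b ∷ P
  setAt (p ∷ P) (suc k) b = p ∷ setAt P k b

  length-setAt : ∀ P k b → length (setAt P k b) ≡ length P
  length-setAt []      k       b = refl
  length-setAt (p ∷ P) zero    b = refl
  length-setAt (p ∷ P) (suc k) b = cong suc (length-setAt P k b)

  or-setAt-true : ∀ P k → k < length P → or (setAt P k true) ≡ true
  or-setAt-true (p ∷ P)     zero    _         = refl
  or-setAt-true (false ∷ P) (suc k) (s≤s k<) = or-setAt-true P k k<
  or-setAt-true (true ∷ P)  (suc k) _         = refl

  or-replicate-false : ∀ n → or (replicate n false) ≡ false
  or-replicate-false zero    = refl
  or-replicate-false (suc n) = or-replicate-false n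

  module Cube {a} {A : Set a} (m : A → A → A → A) where

    cube : ℕ → (List Bool → A) → A
    cube zero          y = y []
    cube (suc zero)    y = y (true ∷ [])
    cube (suc (suc n)) y =
      m (cube (suc n) (y ∘ (false ∷_))) (cube (suc n) (y ∘ (true ∷_))) (y (true ∷ replicate (suc n) false))

    cube-cong : ∀ n {y y′ : List Bool → A} → (∀ P → length P ≡ n → y P ≡ y′ P) → cube n y ≡ cube n y′
    cube-cong zero          H = H [] refl
    cube-cong (suc zero)    H = H (true ∷ []) refl
    cube-cong (suc (suc n)) H =
      cong₃ m (cube-cong (suc n) (λ Q e → H (false ∷ Q) (cong suc e)))
              (cube-cong (suc n) (λ Q e → H (true ∷ Q) (cong suc e)))
              (H (true ∷ replicate (suc n) false) (cong suc (length-replicate (suc n))))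

    cube-cong-nonzero : ∀ n {y y′ : List Bool → A} → 0 < n →
      (∀ P → length P ≡ n → or P ≡ true → y P ≡ y′ P) → cube n y ≡ cube n y′
    cube-cong-nonzero (suc zero)    _ H = H (true ∷ []) refl refl
    cube-cong-nonzero (suc (suc n)) _ H =
      cong₃ m (cube-cong-nonzero (suc n) (s≤s z≤n) (λ Q e t → H (false ∷ Q) (cong suc e) t))
              (cube-cong (suc n) (λ Q e → H (true ∷ Q) (cong suc e) refl))
              (H (true ∷ replicate (suc n) false) (cong suc (length-replicate (suc n))) refl)

    module _ (law₁ : ∀ x y → m x x y ≡ y) (law₂ : ∀ x y → m y x x ≡ y) where

      cube-independent : ∀ n k (y : List Bool → A) → k < n →
        (∀ P → length P ≡ n → y (setAt P k true) ≡ y (setAt P k false)) → cube n y ≡ y (replicate n false)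
      cube-independent (suc zero)    zero    y _ H = H (false ∷ []) refl
      cube-independent (suc zero)    (suc k) y (s≤s ()) H
      cube-independent (suc (suc n)) zero    y _ H = begin
        m (cube (suc n) (y ∘ (false ∷_))) c₁ t ≡⟨ cong (λ u → m u c₁ t) c₁≡c₀ ⟨
        m c₁ c₁ t                              ≡⟨ law₁ c₁ t ⟩
        t                                      ≡⟨ H (false ∷ replicate (suc n) false) (cong suc (length-replicate _)) ⟩
        y (replicate (suc (suc n)) false)      ∎
        where
        open ≡-Reasoning
        c₁ = cube (suc n) (y ∘ (true ∷_))
        t = y (true ∷ replicate (suc n) false)
        c₁≡c₀ : c₁ ≡ cube (suc n) (y ∘ (false ∷_))
        c₁≡c₀ = cube-cong (suc n) (λ Q e → H (false ∷ Q) (cong suc e))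
      cube-independent (suc (suc n)) (suc k) y (s≤s k<) H =
        trans (cong₂ (λ u v → m u v (y (true ∷ replicate (suc n) false)))
                 (cube-independent (suc n) k (y ∘ (false ∷_)) k< (λ Q e → H (false ∷ Q) (cong suc e)))
                 (cube-independent (suc n) k (y ∘ (true ∷_)) k< (λ Q e → H (true ∷ Q) (cong suc e))))
              (law₂ _ _)

  module Words {a} {A : Set a} (m : A → A → A → A) where
    open Cube m

    Word : Set a
    Word = List (A × A) × A

    _◃_ : A × A → Word → Word
    p ◃ w = (p ∷ proj₁ w , proj₂ w)

    firstLetter : List (A × A) → A → A
    firstLetter []            z = z
    firstLetter ((b , _) ∷ _) z = b

    wordOf : (k : ℕ) → (Fin (odd k) → A) → Word
    wordOf zero    v = ([] , v zero)
    wordOf (suc k) v = (v zero , v (suc zero)) ◃ wordOf k (λ j → v (suc (suc j)))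

    length-wordOf : ∀ k v → length (proj₁ (wordOf k v)) ≡ k
    length-wordOf zero    v = refl
    length-wordOf (suc k) v = cong suc (length-wordOf k _)

    -- Selection vectors shorter than the word are padded with false.
    firstBit : List Bool → Bool
    firstBit []      = false
    firstBit (q ∷ _) = q

    laterBits : List Bool → List Bool
    laterBits []      = []
    laterBits (_ ∷ Q) = Q

    -- h is the letter carried into the current pair; merged records whether a pair has been contracted.
    mutual
      contractFrom : A → Bool → List Bool → List (A × A) → A → Word
      contractFrom h merged P []               z = ([] , h)
      contractFrom h merged P ((b , c) ∷ rest) z = contractPair (firstBit P) merged h b c (laterBits P) rest z

      contractPair : Bool → Bool → A → A → A → List Bool → List (A × A) → A → Word
      contractPair false merged h b c Q rest z = (h , c) ◃ contractFrom (firstLetter rest z) false Q rest z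
      contractPair true  false  h b c Q rest z = contractFrom (m b c (firstLetter rest z)) true Q rest z
      contractPair true  true   h b c Q rest z = (h , b) ◃ contractFrom (m b c (firstLetter rest z)) true Q rest z

    contract : List Bool → Word → Word
    contract P (ps , z) = contractFrom (firstLetter ps z) false P ps z

    -- The fuel is never exhausted when it exceeds the number of pairs (catalanOpFuel-stable).
    catalanOpFuel : ℕ → Word → A
    catalanOpFuel zero       (_ , z)      = z
    catalanOpFuel (suc fuel) ([] , z)     = z
    catalanOpFuel (suc fuel) (p ∷ ps , z) =
      cube (suc (length ps)) (λ P → catalanOpFuel fuel (contract P (p ∷ ps , z)))

    catalanOp : Word → A
    catalanOp w = catalanOpFuel (suc (length (proj₁ w))) w

    mutual
      length-contractFrom-≤ : ∀ h merged P ps z → length (proj₁ (contractFrom h merged P ps z)) ≤ length ps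
      length-contractFrom-≤ h merged P []               z = z≤n
      length-contractFrom-≤ h merged P ((b , c) ∷ rest) z =
        length-contractPair-≤ (firstBit P) merged h b c (laterBits P) rest z

      length-contractPair-≤ : ∀ q merged h b c Q rest z →
        length (proj₁ (contractPair q merged h b c Q rest z)) ≤ suc (length rest)
      length-contractPair-≤ false merged h b c Q rest z = s≤s (length-contractFrom-≤ _ _ Q rest z)
      length-contractPair-≤ true  false  h b c Q rest z = m≤n⇒m≤1+n (length-contractFrom-≤ _ _ Q rest z)
      length-contractPair-≤ true  true   h b c Q rest z = s≤s (length-contractFrom-≤ _ _ Q rest z)

    length-contract-< : ∀ h P ps z → length P ≡ length ps → or P ≡ true →
      length (proj₁ (contractFrom h false P ps z)) < length ps
    length-contract-< h []          ps               z e ()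
    length-contract-< h (false ∷ P) ((b , c) ∷ rest) z e t =
      s≤s (length-contract-< _ P rest z (suc-injective e) t)
    length-contract-< h (true ∷ P)  ((b , c) ∷ rest) z e t = s≤s (length-contractFrom-≤ _ _ P rest z)

    contract-zero : ∀ h merged P ps z → h ≡ firstLetter ps z → or P ≡ false →
      contractFrom h merged P ps z ≡ (ps , z)
    contract-zero h merged P           []               z e    _  = cong ([] ,_) e
    contract-zero h merged []          ((b , c) ∷ rest) z refl _  =
      cong ((b , c) ◃_) (contract-zero _ false [] rest z refl refl)
    contract-zero h merged (false ∷ P) ((b , c) ∷ rest) z refl t  =
      cong ((b , c) ◃_) (contract-zero _ false P rest z refl t)
    contract-zero h merged (true ∷ P)  ((b , c) ∷ rest) z _    ()

    catalanOpFuel-stable : ∀ fuel fuel′ w → length (proj₁ w) < fuel → length (proj₁ w) < fuel′ →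
      catalanOpFuel fuel w ≡ catalanOpFuel fuel′ w
    catalanOpFuel-stable (suc fuel) (suc fuel′) ([] , z)     _         _          = refl
    catalanOpFuel-stable (suc fuel) (suc fuel′) (p ∷ ps , z) (s≤s l<) (s≤s l<′) =
      cube-cong-nonzero (suc (length ps)) (s≤s z≤n) λ P e t →
        let shorter = length-contract-< _ P (p ∷ ps) z e t in
        catalanOpFuel-stable fuel fuel′ (contract P (p ∷ ps , z)) (<-≤-trans shorter l<) (<-≤-trans shorter l<′)

    catalanOp-unfold : ∀ ps z → 0 < length ps →
      catalanOp (ps , z) ≡ cube (length ps) (λ P → catalanOp (contract P (ps , z)))
    catalanOp-unfold (p ∷ ps) z n>0 = cube-cong-nonzero (suc (length ps)) n>0 λ P e t →
      catalanOpFuel-stable _ _ (contract P (p ∷ ps , z)) (length-contract-< _ P (p ∷ ps) z e t) (n<1+n _)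

    -- The three kinds of equal adjacent letters in x₁ … x₂ₖ₊₁: x₂ᵢ₋₁ = x₂ᵢ, x₂ₖ = x₂ₖ₊₁ and x₂ᵢ = x₂ᵢ₊₁.
    data _⟶_ : Word → Word → Set a where
      cancel-pair   : ∀ E b c rest z → c ≡ b → (E ++ (b , c) ∷ rest , z) ⟶ (E ++ rest , z)
      cancel-last   : ∀ E b c z → c ≡ z → (E ++ (b , c) ∷ [] , z) ⟶ (E ++ [] , b)
      cancel-across : ∀ E b c d c′ rest z → c ≡ d →
        (E ++ (b , c) ∷ (d , c′) ∷ rest , z) ⟶ (E ++ (b , c′) ∷ rest , z)

    ◃-⟶ : ∀ p {w w′} → w ⟶ w′ → (p ◃ w) ⟶ (p ◃ w′)
    ◃-⟶ p (cancel-pair E b c rest z e)         = cancel-pair (p ∷ E) b c rest z e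
    ◃-⟶ p (cancel-last E b c z e)              = cancel-last (p ∷ E) b c z e
    ◃-⟶ p (cancel-across E b c d c′ rest z e) = cancel-across (p ∷ E) b c d c′ rest z e

    wordOf-⟶ : ∀ k (i : Fin (suc (odd k))) (x : Fin (odd (suc k)) → A) →
      x (inject₁ i) ≡ x (suc i) → wordOf (suc k) x ⟶ wordOf k (remove2 x i)
    wordOf-⟶ k       zero                x e = cancel-pair [] _ _ _ _ (sym e)
    wordOf-⟶ zero    (suc zero)          x e = cancel-last [] _ _ _ e
    wordOf-⟶ (suc k) (suc zero)          x e = cancel-across [] _ _ _ _ _ _ e
    wordOf-⟶ (suc k) (suc (suc i))       x e = ◃-⟶ _ (wordOf-⟶ k i (λ j → x (suc (suc j))) e)

    _⟶⁼_ : Word → Word → Set a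
    w ⟶⁼ w′ = w ≡ w′ ⊎ w ⟶ w′

    ◃-⟶⁼ : ∀ p {w w′} → w ⟶⁼ w′ → (p ◃ w) ⟶⁼ (p ◃ w′)
    ◃-⟶⁼ p (inj₁ e) = inj₁ (cong (p ◃_) e)
    ◃-⟶⁼ p (inj₂ s) = inj₂ (◃-⟶ p s)

    Joinable : Word → Word → Set a
    Joinable w w′ = Σ Word λ v → w ⟶⁼ v × w′ ⟶⁼ v

    ◃-Joinable : ∀ p {w w′} → Joinable w w′ → Joinable (p ◃ w) (p ◃ w′)
    ◃-Joinable p (v , s , s′) = p ◃ v , ◃-⟶⁼ p s , ◃-⟶⁼ p s′

    CarryInvariant : A → Bool → List (A × A) → A → Set a
    CarryInvariant h merged ps z = merged ≡ false → h ≡ firstLetter ps z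

    contractFrom-merged-⟶⁼ : ∀ Q rest z →
      contractFrom (firstLetter rest z) true Q rest z ⟶⁼ contractFrom (firstLetter rest z) false Q rest z
    contractFrom-merged-⟶⁼ Q           []                 z = inj₁ refl
    contractFrom-merged-⟶⁼ []          ((b′ , c′) ∷ rest) z = inj₁ refl
    contractFrom-merged-⟶⁼ (false ∷ Q) ((b′ , c′) ∷ rest) z = inj₁ refl
    contractFrom-merged-⟶⁼ (true ∷ Q)  ((b′ , c′) ∷ rest) z = inj₂ (cancel-pair [] b′ b′ _ _ refl)

    -- A cancellation at the start of the suffix X , z of a word, turning that suffix into w′.
    record CancellationSite (X : List (A × A)) (z : A) (w′ : Word) : Set a where
      field
        nonempty : 0 < length X
        flip-joinable : ∀ h merged Q → CarryInvariant h merged X z →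
          Joinable (contractFrom h merged (true ∷ Q) X z) (contractFrom h merged (false ∷ Q) X z)
        contract-single : ∀ h Q → h ≡ firstLetter X z → or Q ≡ false →
          contractFrom h false (true ∷ Q) X z ≡ w′

    module _ {X z w′} (site : CancellationSite X z w′) where
      open CancellationSite site

      flip-joinable-after : ∀ E h merged P → CarryInvariant h merged (E ++ X) z →
        Joinable (contractFrom h merged (setAt P (length E) true) (E ++ X) z)
                 (contractFrom h merged (setAt P (length E) false) (E ++ X) z)
      flip-joinable-after E              h merged []          inv = _ , inj₁ refl , inj₁ refl
      flip-joinable-after []             h merged (p ∷ Q)     inv = flip-joinable h merged Q inv
      flip-joinable-after ((b , c) ∷ E) h merged (false ∷ Q) inv =
        ◃-Joinable (h , c) (flip-joinable-after E _ false Q (λ _ → refl))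
      flip-joinable-after ((b , c) ∷ E) h false  (true ∷ Q)  inv = flip-joinable-after E _ true Q (λ ())
      flip-joinable-after ((b , c) ∷ E) h true   (true ∷ Q)  inv =
        ◃-Joinable (h , b) (flip-joinable-after E _ true Q (λ ()))

      contract-single-after : ∀ E h P → h ≡ firstLetter (E ++ X) z → length E < length P →
        or (setAt P (length E) false) ≡ false →
        contractFrom h false (setAt P (length E) true) (E ++ X) z ≡ (E ++ proj₁ w′ , proj₂ w′)
      contract-single-after []             h (p ∷ Q)     e    _         t = contract-single h Q e t
      contract-single-after ((b , c) ∷ E) h (false ∷ Q) refl (s≤s E<) t =
        cong ((b , c) ◃_) (contract-single-after E _ Q refl E< t)
      contract-single-after ((b , c) ∷ E) h (true ∷ Q)  e    _         ()

  module CancellationInvariance {a} {A : Set a} (m : A → A → A → A)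
                               (law₁ : ∀ x y → m x x y ≡ y) (law₂ : ∀ x y → m y x x ≡ y) where
    open Cube m
    open Words m

    pair-site : ∀ b rest z → CancellationSite ((b , b) ∷ rest) z (rest , z)
    pair-site b rest z = record
      { nonempty = s≤s z≤n ; flip-joinable = joinable ; contract-single = single }
      where
      joinable : ∀ h merged Q → CarryInvariant h merged ((b , b) ∷ rest) z →
        Joinable (contractFrom h merged (true ∷ Q) ((b , b) ∷ rest) z)
                 (contractFrom h merged (false ∷ Q) ((b , b) ∷ rest) z)
      joinable h false Q inv rewrite inv refl | law₁ b (firstLetter rest z) =
        _ , contractFrom-merged-⟶⁼ Q rest z , inj₂ (cancel-pair [] b b _ _ refl)
      joinable h true Q inv rewrite law₁ b (firstLetter rest z) =
        _ , ◃-⟶⁼ (h , b) (contractFrom-merged-⟶⁼ Q rest z) , inj₁ refl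
      single : ∀ h Q → h ≡ b → or Q ≡ false → contractFrom h false (true ∷ Q) ((b , b) ∷ rest) z ≡ (rest , z)
      single h Q _ t rewrite law₁ b (firstLetter rest z) = contract-zero _ true Q rest z refl t

    last-site : ∀ b c → CancellationSite ((b , c) ∷ []) c ([] , b)
    last-site b c = record
      { nonempty = s≤s z≤n ; flip-joinable = joinable ; contract-single = λ h Q _ _ → cong ([] ,_) (law₂ c b) }
      where
      joinable : ∀ h merged Q → CarryInvariant h merged ((b , c) ∷ []) c →
        Joinable (contractFrom h merged (true ∷ Q) ((b , c) ∷ []) c)
                 (contractFrom h merged (false ∷ Q) ((b , c) ∷ []) c)
      joinable h false Q inv rewrite inv refl | law₂ c b = _ , inj₁ refl , inj₂ (cancel-last [] b c c refl)
      joinable h true Q inv rewrite law₂ c b =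
        ([] , h) , inj₂ (cancel-last [] h b b refl) , inj₂ (cancel-last [] h c c refl)

    across-site : ∀ b c c′ rest z → CancellationSite ((b , c) ∷ (c , c′) ∷ rest) z ((b , c′) ∷ rest , z)
    across-site b c c′ rest z = record
      { nonempty = s≤s z≤n ; flip-joinable = joinable ; contract-single = single }
      where
      X = (b , c) ∷ (c , c′) ∷ rest
      joinable : ∀ h merged Q → CarryInvariant h merged X z →
        Joinable (contractFrom h merged (true ∷ Q) X z) (contractFrom h merged (false ∷ Q) X z)
      joinable h false Q inv rewrite inv refl | law₂ c b with firstBit Q
      ... | false = _ , inj₁ refl , inj₂ (cancel-across [] b c c c′ _ _ refl)
      ... | true  = _ , inj₁ refl , inj₁ refl
      joinable h true Q inv rewrite law₂ c b with firstBit Q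
      ... | false = _ , inj₂ (cancel-across [] h b b c′ _ _ refl) , inj₂ (cancel-across [] h c c c′ _ _ refl)
      ... | true  = _ , inj₂ (cancel-across [] h b b c _ _ refl) , inj₁ refl
      single : ∀ h Q → h ≡ b → or Q ≡ false → contractFrom h false (true ∷ Q) X z ≡ ((b , c′) ∷ rest , z)
      single h []          _ _ rewrite law₂ c b = cong ((b , c′) ◃_) (contract-zero _ false [] rest z refl refl)
      single h (false ∷ Q) _ t rewrite law₂ c b = cong ((b , c′) ◃_) (contract-zero _ false Q rest z refl t)
      single h (true ∷ Q)  _ ()

    CancelInvariantBelow : ℕ → Set a
    CancelInvariantBelow N = ∀ w w′ → length (proj₁ w) < N → w ⟶ w′ → catalanOp w ≡ catalanOp w′

    ⟶⁼-invariant : ∀ {N w v} → CancelInvariantBelow N → length (proj₁ w) < N → w ⟶⁼ v →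
      catalanOp w ≡ catalanOp v
    ⟶⁼-invariant IH l< (inj₁ e) = cong catalanOp e
    ⟶⁼-invariant IH l< (inj₂ s) = IH _ _ l< s

    -- y′ is the summand y of the unfolded catalanOp with its unread value at 0 replaced by the target.
    catalanOp-cancel-at : ∀ N E {X z w′} → CancellationSite X z w′ → CancelInvariantBelow N →
      length (E ++ X) < suc N → catalanOp (E ++ X , z) ≡ catalanOp (E ++ proj₁ w′ , proj₂ w′)
    catalanOp-cancel-at N E {X} {z} {w′} site IH (s≤s l≤N) = begin
      catalanOp (ps , z)     ≡⟨ catalanOp-unfold ps z n>0 ⟩
      cube n y               ≡⟨ cube-cong-nonzero n n>0 (λ P _ t → sym (y′-nonzero P t)) ⟩
      cube n y′              ≡⟨ cube-independent law₁ law₂ n k y′ k<n y′-independent ⟩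
      y′ (replicate n false) ≡⟨ cong (if_then y (replicate n false) else target) (or-replicate-false n) ⟩
      target                 ∎
      where
      open ≡-Reasoning
      ps = E ++ X
      n = length ps
      k = length E
      target = catalanOp (E ++ proj₁ w′ , proj₂ w′)
      y y′ : List Bool → A
      y P = catalanOp (contract P (ps , z))
      y′ P = if or P then y P else target
      k<n : k < n
      k<n = subst (k <_) (sym (length-++ E)) (m<m+n k (CancellationSite.nonempty site))
      n>0 : 0 < n
      n>0 = ≤-trans (s≤s z≤n) k<n
      y′-nonzero : ∀ P → or P ≡ true → y′ P ≡ y P
      y′-nonzero P t = cong (if_then y P else target) t
      y′-independent : ∀ P → length P ≡ n → y′ (setAt P k true) ≡ y′ (setAt P k false)
      y′-independent P len =
        trans (y′-nonzero _ (or-setAt-true P k k<P)) (y-flip (or (setAt P k false)) refl)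
        where
        k<P : k < length P
        k<P = subst (k <_) (sym len) k<n
        shorter : ∀ b → or (setAt P k b) ≡ true → length (proj₁ (contract (setAt P k b) (ps , z))) < N
        shorter b t = <-≤-trans (length-contract-< _ _ ps z (trans (length-setAt P k b) len) t) l≤N
        y-flip : ∀ b → or (setAt P k false) ≡ b → y (setAt P k true) ≡ y′ (setAt P k false)
        y-flip true t with flip-joinable-after site E (firstLetter ps z) false P (λ _ → refl)
        ... | v , s , s′ = trans (⟶⁼-invariant IH (shorter true (or-setAt-true P k k<P)) s)
          (trans (sym (⟶⁼-invariant IH (shorter false t) s′)) (sym (y′-nonzero _ t)))
        y-flip false t = trans (cong catalanOp (contract-single-after site E _ P refl k<P t))
                               (sym (cong (if_then y (setAt P k false) else target) t))

    catalanOp-cancel-below : ∀ N → CancelInvariantBelow N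
    catalanOp-cancel-below zero    w w′ () s
    catalanOp-cancel-below (suc N) _ _ l< (cancel-pair E b c rest z refl) =
      catalanOp-cancel-at N E (pair-site b rest z) (catalanOp-cancel-below N) l<
    catalanOp-cancel-below (suc N) _ _ l< (cancel-last E b c z refl) =
      catalanOp-cancel-at N E (last-site b c) (catalanOp-cancel-below N) l<
    catalanOp-cancel-below (suc N) _ _ l< (cancel-across E b c d c′ rest z refl) =
      catalanOp-cancel-at N E (across-site b c c′ rest z) (catalanOp-cancel-below N) l<

    catalanOp-cancel : ∀ {w w′} → w ⟶ w′ → catalanOp w ≡ catalanOp w′
    catalanOp-cancel {w} = catalanOp-cancel-below (suc (length (proj₁ w))) _ _ ≤-refl

  module Homomorphism {a b} {A : Set a} {B : Set b} (mA : A → A → A → A) (mB : B → B → B → B) (h : A → B)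
                      (hom : ∀ u v w → h (mA u v w) ≡ mB (h u) (h v) (h w)) where
    module CA = Cube mA
    module CB = Cube mB
    module WA = Words mA
    module WB = Words mB

    mapPairs : List (A × A) → List (B × B)
    mapPairs = map (×.map h h)

    mapWord : WA.Word → WB.Word
    mapWord = ×.map mapPairs h

    firstLetter-map : ∀ ps z → h (WA.firstLetter ps z) ≡ WB.firstLetter (mapPairs ps) (h z)
    firstLetter-map []      z = refl
    firstLetter-map (_ ∷ _) z = refl

    m-firstLetter-map : ∀ b c rest z →
      h (mA b c (WA.firstLetter rest z)) ≡ mB (h b) (h c) (WB.firstLetter (mapPairs rest) (h z))
    m-firstLetter-map b c rest z = trans (hom b c _) (cong (mB (h b) (h c)) (firstLetter-map rest z))

    mutual
      contractFrom-map : ∀ g merged P ps z →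
        mapWord (WA.contractFrom g merged P ps z) ≡ WB.contractFrom (h g) merged P (mapPairs ps) (h z)
      contractFrom-map g merged P []               z = refl
      contractFrom-map g merged P ((b , c) ∷ rest) z =
        contractPair-map (WA.firstBit P) merged g b c (WA.laterBits P) rest z

      contractPair-map : ∀ q merged g b c Q rest z →
        mapWord (WA.contractPair q merged g b c Q rest z)
          ≡ WB.contractPair q merged (h g) (h b) (h c) Q (mapPairs rest) (h z)
      contractPair-map false merged g b c Q rest z = cong ((h g , h c) WB.◃_)
        (trans (contractFrom-map _ false Q rest z)
               (cong (λ u → WB.contractFrom u false Q (mapPairs rest) (h z)) (firstLetter-map rest z)))
      contractPair-map true false g b c Q rest z =
        trans (contractFrom-map _ true Q rest z)
              (cong (λ u → WB.contractFrom u true Q (mapPairs rest) (h z)) (m-firstLetter-map b c rest z))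
      contractPair-map true true g b c Q rest z = cong ((h g , h b) WB.◃_)
        (trans (contractFrom-map _ true Q rest z)
               (cong (λ u → WB.contractFrom u true Q (mapPairs rest) (h z)) (m-firstLetter-map b c rest z)))

    cube-map : ∀ n y → h (CA.cube n y) ≡ CB.cube n (h ∘ y)
    cube-map zero          y = refl
    cube-map (suc zero)    y = refl
    cube-map (suc (suc n)) y =
      trans (hom _ _ _) (cong₂ (λ u v → mB u v (h (y (true ∷ replicate (suc n) false))))
                               (cube-map (suc n) _) (cube-map (suc n) _))

    catalanOpFuel-map : ∀ fuel w → h (WA.catalanOpFuel fuel w) ≡ WB.catalanOpFuel fuel (mapWord w)
    catalanOpFuel-map zero       w            = refl
    catalanOpFuel-map (suc fuel) ([] , z)     = refl
    catalanOpFuel-map (suc fuel) (p ∷ ps , z) = begin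
      h (CA.cube (suc (length ps)) (λ P → WA.catalanOpFuel fuel (WA.contract P (p ∷ ps , z))))
        ≡⟨ cube-map (suc (length ps)) _ ⟩
      CB.cube (suc (length ps)) (λ P → h (WA.catalanOpFuel fuel (WA.contract P (p ∷ ps , z))))
        ≡⟨ CB.cube-cong (suc (length ps)) (λ P _ →
             trans (catalanOpFuel-map fuel _) (cong (WB.catalanOpFuel fuel) (contractFrom-map _ false P (p ∷ ps) z))) ⟩
      CB.cube (suc (length ps)) (λ P → WB.catalanOpFuel fuel (WB.contract P (mapWord (p ∷ ps , z))))
        ≡⟨ cong (λ n → CB.cube (suc n) (λ P → WB.catalanOpFuel fuel (WB.contract P (mapWord (p ∷ ps , z)))))
                (sym (length-map (×.map h h) ps)) ⟩
      WB.catalanOpFuel (suc fuel) (mapWord (p ∷ ps , z)) ∎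
      where open ≡-Reasoning

    wordOf-map : ∀ k v → mapWord (WA.wordOf k v) ≡ WB.wordOf k (h ∘ v)
    wordOf-map zero    v = refl
    wordOf-map (suc k) v = cong (_ WB.◃_) (wordOf-map k _)

  module Closure {a ℓ} {A : Set a} (m : A → A → A → A) (Q : A → Set ℓ)
                 (m-closed : ∀ {u v w} → Q u → Q v → Q w → Q (m u v w)) where
    open Cube m
    open Words m

    WordIn : Word → Set (a ⊔ ℓ)
    WordIn (ps , z) = All (λ p → Q (proj₁ p) × Q (proj₂ p)) ps × Q z

    firstLetter-closed : ∀ {ps z} → WordIn (ps , z) → Q (firstLetter ps z)
    firstLetter-closed ([]                , qz) = qz
    firstLetter-closed ((qb , _) ∷ _      , _)  = qb

    mutual
      contractFrom-closed : ∀ {g} merged P {ps z} → Q g → WordIn (ps , z) →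
        WordIn (contractFrom g merged P ps z)
      contractFrom-closed merged P qg ([]            , qz) = [] , qg
      contractFrom-closed merged P qg (qbc ∷ qrest , qz) =
        contractPair-closed (firstBit P) merged (laterBits P) qg qbc (qrest , qz)

      contractPair-closed : ∀ q merged R {g b c rest z} → Q g → Q b × Q c → WordIn (rest , z) →
        WordIn (contractPair q merged g b c R rest z)
      contractPair-closed false merged R qg (qb , qc) qw
        with contractFrom-closed false R (firstLetter-closed qw) qw
      ... | qps , qz = ((qg , qc) ∷ qps) , qz
      contractPair-closed true false R qg (qb , qc) qw =
        contractFrom-closed true R (m-closed qb qc (firstLetter-closed qw)) qw
      contractPair-closed true true R qg (qb , qc) qw
        with contractFrom-closed true R (m-closed qb qc (firstLetter-closed qw)) qw
      ... | qps , qz = ((qg , qb) ∷ qps) , qz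

    cube-closed : ∀ n {y} → (∀ P → Q (y P)) → Q (cube n y)
    cube-closed zero          H = H []
    cube-closed (suc zero)    H = H _
    cube-closed (suc (suc n)) H = m-closed (cube-closed (suc n) (H ∘ _)) (cube-closed (suc n) (H ∘ _)) (H _)

    catalanOpFuel-closed : ∀ fuel {w} → WordIn w → Q (catalanOpFuel fuel w)
    catalanOpFuel-closed zero       (_ , qz) = qz
    catalanOpFuel-closed (suc fuel) {[] , z}     (_ , qz) = qz
    catalanOpFuel-closed (suc fuel) {p ∷ ps , z} qw =
      cube-closed (suc (length ps)) λ P →
        catalanOpFuel-closed fuel (contractFrom-closed false P (firstLetter-closed qw) qw)

    wordOf-closed : ∀ k {v} → (∀ i → Q (v i)) → WordIn (wordOf k v)
    wordOf-closed zero    H = [] , H zero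
    wordOf-closed (suc k) H with wordOf-closed k (λ j → H (suc (suc j)))
    ... | qps , qz = ((H zero , H (suc zero)) ∷ qps) , qz

open import Data.Fin using (zero; suc)
open import Data.Nat using (ℕ; suc; _<_)
open import Data.Nat.Properties using (≤-refl)
open import Data.Product using (_×_; _,_; Σ)
open import Data.Vec.Functional using ([]; _∷_)
open import Relation.Binary.PropositionalEquality using (_≡_; refl; sym; trans; cong; subst)

ternary : ∀ {a} {D : Set a} → Op D 3 → D → D → D → D
ternary φ x y z = φ (x ∷ y ∷ z ∷ [])

ternary-InClone : ∀ {a} {D : Set a} {φ : Op D 3} {n} {u v w : Op D n} →
  InClone φ u → InClone φ v → InClone φ w → InClone φ (λ x → ternary φ (u x) (v x) (w x))
ternary-InClone {φ = φ} {u = u} {v} {w} cu cv cw = comp {g = λ j x → (u x ∷ v x ∷ w x ∷ []) j} gen arguments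
  where
  arguments : ∀ j → InClone φ (λ x → (u x ∷ v x ∷ w x ∷ []) j)
  arguments zero             = cu
  arguments (suc zero)       = cv
  arguments (suc (suc zero)) = cw

module _ {a} {D : Set a} (φ : Op D 3) where
  open Construction.Words (ternary φ)

  catalanOps : OddOps D
  catalanOps k x = catalanOpFuel (suc k) (wordOf k x)

  catalanOps-≡-catalanOp : ∀ k x → catalanOps k x ≡ catalanOp (wordOf k x)
  catalanOps-≡-catalanOp k x =
    catalanOpFuel-stable (suc k) _ (wordOf k x) (subst (_< suc k) (sym (length-wordOf k x)) ≤-refl) ≤-refl

  catalanOps-catalan : (∀ x y → ternary φ x x y ≡ y) → (∀ x y → ternary φ y x x ≡ y) → Catalan catalanOps
  catalanOps-catalan law₁ law₂ = (λ x → refl) , λ k i x e →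
    trans (catalanOps-≡-catalanOp (suc k) x)
      (trans (catalanOp-cancel (wordOf-⟶ k i x e)) (sym (catalanOps-≡-catalanOp k (remove2 x i))))
    where open Construction.CancellationInvariance (ternary φ) law₁ law₂ using (catalanOp-cancel)

  catalanOps-InClone : ∀ k → InClone φ (catalanOps k)
  catalanOps-InClone k = ext (catalanOpFuel-closed (suc k) (wordOf-closed k proj)) evaluate
    where
    pointwise : Op D (odd k) → Op D (odd k) → Op D (odd k) → Op D (odd k)
    pointwise u v w x = ternary φ (u x) (v x) (w x)
    module Pointwise = Construction.Words pointwise
    open Construction.Closure pointwise (InClone φ) ternary-InClone
    projections : Pointwise.Word
    projections = Pointwise.wordOf k (λ i x → x i)
    evaluate : ∀ x → Pointwise.catalanOpFuel (suc k) projections x ≡ catalanOps k x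
    evaluate x = trans (catalanOpFuel-map (suc k) projections) (cong (catalanOpFuel (suc k)) (wordOf-map k _))
      where open Construction.Homomorphism pointwise (ternary φ) (λ t → t x) (λ _ _ _ → refl)

catalan⇒maltsev : ∀ {a} {D : Set a} (f : OddOps D) → Catalan f →
  (∀ x y → f 1 (x ∷ x ∷ y ∷ []) ≡ y) × (∀ x y → f 1 (y ∷ x ∷ x ∷ []) ≡ y)
catalan⇒maltsev f (unary , cancel) =
  (λ x y → trans (cancel 0 zero _ refl) (unary _)) , (λ x y → trans (cancel 0 (suc zero) _ refl) (unary _))

theorem7p4 : ∀ {a} {D : Set a} →
    ((φ : Op D 3) →
      (∀ x y → φ (x ∷ x ∷ y ∷ []) ≡ y) →
      (∀ x y → φ (y ∷ x ∷ x ∷ []) ≡ y) →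
      Σ (OddOps D) (λ f → ((k : ℕ) → InClone φ (f k)) × Catalan f))
    ×
    ((f : OddOps D) → Catalan f →
      (∀ x y → f 1 (x ∷ x ∷ y ∷ []) ≡ y)
      × (∀ x y → f 1 (y ∷ x ∷ x ∷ []) ≡ y))
theorem7p4 =
  (λ φ law₁ law₂ → catalanOps φ , catalanOps-InClone φ , catalanOps-catalan φ law₁ law₂) , catalan⇒maltsev
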